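{- Let $G = \prod_{i=1}^t K[a_i,b_i]$, where $2 \leq b_1 \leq \cdots \leq b_t$. Let $S$ be an irredundant set in $G$, and let $T \subseteq \mathrm{pn}[S]$ be chosen so that each vertex of $S$ has exactly one private neighbor in $T$. If there are two distinct vertices $v_1,v_2 \in T$ with $p(v_1) = p(v_2)$, then $v_1$ and $v_2$ are lonely vertices of $S$.
   Context: $K[a,b]$ is the balanced complete $b$-partite graph with parts of size $a$. Label the vertices of $K[a_i,b_i]$ by $\mathbb{Z}/a_ib_i\mathbb{Z}$, two vertices being adjacent iff they are not congruent modulo $b_i$. The direct product $\prod_i G_i$ has tuples as vertices, adjacent iff adjacent in every coordinate. For $v\in V(G)$ write $v=(v(1),\dots,v(t))$ with $v(i)\in\{0,\dots,a_ib_i-1\}$ and $p(v)=(v(1)\bmod b_1,\dots,v(t)\bmod b_t)$; so $u,v$ are adjacent iff $p(u)$ and $p(v)$ differ in every coordinate. For $S\subseteq V(G)$ and $v\in S$, $\mathrm{pn}[v;S]=N[v]\setminus N[S\setminus\{v\}]$ is the set of private neighbors of $v$ (closed neighborhoods; $v$ itself may be one), $\mathrm{pn}[S]=\bigcup_{v\in S}\mathrm{pn}[v;S]$, and $S$ is irredundant if $\mathrm{pn}[v;S]\ne\emptyset$ for all $v\in S$. A vertex $v\in S$ is lonely if it is isolated in the induced subgraph $G[S]$; "$v$ is a lonely vertex of $S$" means $v\in S$ and $v$ is lonely. -}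

module Defs where

open import Data.Nat using (ℕ; _*_; _≤_; _<_; NonZero; >-nonZero; s≤s; z≤n)
open import Data.Nat.Properties using (≤-trans)
open import Data.Nat.DivMod using (_%_)
open import Data.Fin using (Fin; toℕ)
open import Data.Product using (Σ; ∃; _×_)
open import Data.Sum using (_⊎_)
open import Relation.Nullary using (¬_)
open import Relation.Binary.PropositionalEquality using (_≡_; _≢_)

-- The direct product G = ∏_{i < t} K[a i , b i], with the vertices of
-- K[a i , b i] labelled by Fin (a i * b i) ≅ ℤ/(a i b i)ℤ.
module Product (t : ℕ) (a b : Fin t → ℕ) (b≥2 : ∀ i → 2 ≤ b i) where

  nz : ∀ i → NonZero (b i)
  nz i = >-nonZero (≤-trans (s≤s z≤n) (b≥2 i))

  Vertex : Set
  Vertex = (i : Fin t) → Fin (a i * b i)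

  _≈_ : Vertex → Vertex → Set
  u ≈ v = ∀ i → u i ≡ v i

  p : Vertex → Fin t → ℕ
  p v i = _%_ (toℕ (v i)) (b i) {{nz i}}

  Adj : Vertex → Vertex → Set
  Adj u v = ∀ i → p u i ≢ p v i

  InN : Vertex → Vertex → Set
  InN v w = w ≈ v ⊎ Adj v w

  VSet : Set₁
  VSet = Vertex → Set

  PN : VSet → Vertex → Vertex → Set
  PN S v w = InN v w × (∀ u → S u → ¬ (u ≈ v) → ¬ InN u w)

  PNSet : VSet → Vertex → Set
  PNSet S w = ∃ λ v → S v × PN S v w

  Irredundant : VSet → Set
  Irredundant S = ∀ v → S v → ∃ λ w → PN S v w

  Lonely : VSet → Vertex → Set
  Lonely S v = S v × (∀ u → S u → ¬ Adj v u)

  -- S is a genuine set of vertices (closed under vertex equality)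
  RespectsEq : VSet → Set
  RespectsEq S = ∀ u v → u ≈ v → S u → S v

module Submission where

-- Adjacency in G = ∏ K[aᵢ,bᵢ] depends only on the
-- residue vector p, so two vertices v₁ ≉ v₂ of T with p v₁ = p v₂ have the
-- same neighbours.  Let v₁ be the private neighbour of s₁ ∈ S.  If v₁ ≠ s₁
-- then s₁ is adjacent to v₁, hence to v₂; a private neighbour of some s₂
-- that is also dominated by s₁ is a private neighbour of s₁, so v₁ and v₂
-- would be two different private neighbours of s₁ in T, contradicting the
-- choice of T.  Hence v₁ = s₁ ∈ S.  A private neighbour that lies in S and
-- is its own owner is lonely: a neighbour u ∈ S of it would dominate it,
-- forcing u = v₁ and so a loop at v₁, which only exists when t = 0, i.e.
-- when G has a single vertex (excluded by v₁ ≉ v₂).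

open import Defs
open import Data.Nat using (ℕ; _≤_)
open import Data.Fin using (Fin; toℕ)
open import Data.Nat.DivMod using (_%_)
open import Data.Fin.Base using () renaming (_≤_ to _≤ᶠ_)
open import Data.Product using (∃; _×_; _,_)
open import Data.Sum using (inj₁; inj₂)
open import Data.Empty using (⊥-elim)
open import Relation.Nullary using (¬_)
open import Relation.Binary.PropositionalEquality using (_≡_; refl; sym; trans; cong)

module Properties (t : ℕ) (a b : Fin t → ℕ) (b≥2 : ∀ i → 2 ≤ b i) where
  open Product t a b b≥2

  ≈-sym : ∀ {u v} → u ≈ v → v ≈ u
  ≈-sym e i = sym (e i)

  ≈-trans : ∀ {u v w} → u ≈ v → v ≈ w → u ≈ w
  ≈-trans e f i = trans (e i) (f i)

  p-cong : ∀ {u v} → u ≈ v → ∀ i → p u i ≡ p v i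
  p-cong e i = cong (λ x → _%_ (toℕ x) (b i) {{nz i}}) (e i)

  Adj-sym : ∀ {u v} → Adj u v → Adj v u
  Adj-sym adj i e = adj i (sym e)

  Adj-respects-p : ∀ {s u u′} → (∀ i → p u i ≡ p u′ i) → Adj s u → Adj s u′
  Adj-respects-p same adj i e = adj i (trans e (sym (same i)))

  -- A loop forces every coordinate set to be empty (t = 0), so G has one vertex.
  loop⇒trivial : ∀ {u} → Adj u u → ∀ x y → x ≈ y
  loop⇒trivial loop x y i = ⊥-elim (loop i refl)

  PN-shift : ∀ {S s s′ w} → PN S s w → S s′ → InN s′ w → PN S s′ w
  PN-shift {s′ = s′} (_ , exclusive) Ss′ s′w =
    s′w , λ u Su u≉s′ uw →
      exclusive u Su (λ u≈s → exclusive s′ Ss′ (λ s′≈s → u≉s′ (≈-trans u≈s (≈-sym s′≈s))) s′w) uw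

  twin-is-owner : ∀ {S T : VSet} {s w w′}
    → (∀ x → T x → PNSet S x)
    → (∀ v → S v → ∃ λ x → T x × PN S v x × (∀ x′ → T x′ → PN S v x′ → x′ ≈ x))
    → S s → PN S s w → T w → T w′ → ¬ (w ≈ w′) → (∀ i → p w i ≡ p w′ i)
    → w ≈ s
  twin-is-owner _ _ _ (inj₁ w≈s , _) _ _ _ _ = w≈s
  twin-is-owner {S} {s = s} {w} {w′} pnT uniqueT Ss pn@(inj₂ adj , _) Tw Tw′ w≉w′ same
    with pnT w′ Tw′ | uniqueT s Ss
  ... | _ , _ , pn′ | _ , _ , _ , onlyX =
    ⊥-elim (w≉w′ (≈-trans (onlyX w Tw pn) (≈-sym (onlyX w′ Tw′ pn′→s))))
    where
      pn′→s : PN S s w′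
      pn′→s = PN-shift pn′ Ss (inj₂ (Adj-respects-p same adj))

  self-private⇒lonely : ∀ {S : VSet} {s w} → RespectsEq S → ¬ (∀ x y → x ≈ y)
    → S s → PN S s w → w ≈ s → Lonely S w
  self-private⇒lonely {S} {s} {w} respS nontrivial Ss (_ , exclusive) w≈s =
    respS s w (≈-sym w≈s) Ss , noNeighbour
    where
      noNeighbour : ∀ u → S u → ¬ Adj w u
      noNeighbour u Su adj = exclusive u Su u≉s (inj₂ (Adj-sym adj))
        where
          u≉s : ¬ (u ≈ s)
          u≉s u≈s = nontrivial (loop⇒trivial {w}
            (Adj-respects-p (p-cong (≈-trans u≈s (≈-sym w≈s))) adj))

lemma5p3 : (t : ℕ) (a b : Fin t → ℕ) (b≥2 : ∀ i → 2 ≤ b i)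
    → (∀ i j → i ≤ᶠ j → b i ≤ b j)
    → let open Product t a b b≥2 in
    (S T : VSet) → RespectsEq S → RespectsEq T
    → Irredundant S
    → (∀ w → T w → PNSet S w)
    → (∀ v → S v → ∃ λ w → T w × PN S v w × (∀ w′ → T w′ → PN S v w′ → w′ ≈ w))
    → (v₁ v₂ : Vertex) → T v₁ → T v₂ → ¬ (v₁ ≈ v₂)
    → (∀ i → p v₁ i ≡ p v₂ i)
    → Lonely S v₁ × Lonely S v₂
lemma5p3 t a b b≥2 _ S T respS _ _ pnT uniqueT v₁ v₂ Tv₁ Tv₂ v₁≉v₂ same =
  twin-lonely v₁ v₂ Tv₁ Tv₂ v₁≉v₂ same ,
  twin-lonely v₂ v₁ Tv₂ Tv₁ (λ e → v₁≉v₂ (≈-sym e)) (λ i → sym (same i))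
  where
    open Product t a b b≥2
    open Properties t a b b≥2

    twin-lonely : ∀ w w′ → T w → T w′ → ¬ (w ≈ w′) → (∀ i → p w i ≡ p w′ i) → Lonely S w
    twin-lonely w w′ Tw Tw′ w≉w′ sameP with pnT w Tw
    ... | s , Ss , pn =
      self-private⇒lonely respS (λ all → w≉w′ (all w w′)) Ss pn
        (twin-is-owner pnT uniqueT Ss pn Tw Tw′ w≉w′ sameP)
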